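{- Let $a,b$ be positive integers and $\Delta\in\mathrm{CONF}(a,b)$ with characteristic sequence $\{x_0,\dots,x_{b-1}\}$. Define $\mu_{ -1}=\mu_0=0$ and, for $1\le j\le b$, $\mu_j=\min_{0\le i\le b-1}(x_i+x_{i+1}+\dots+x_{i+j-1})$, with indices mod $b$. Then $\Delta$ is regular if and only if $1+\mu_j>\frac{a}{b}j$ for all $-1\le j\le b$.
   Context: $\mathrm{CONF}(a,b)$ is the set of necklaces (circular arrangements up to rotation) of $a$ red and $b$ black beads. For $\Delta$ with black beads $B_0,\dots,B_{b-1}$ in cyclic order, its characteristic sequence lists the number $x_i$ of red beads between $B_i$ and $B_{i+1}$ (indices mod $b$); it has sum $a$ and is defined up to cyclic shift. $\Delta$ is regular if $\frac{a}{b}k-1<x_i+\dots+x_{i+k-1}<\frac{a}{b}k+1$ for all $0\le i\le b-1$ and $1\le k\le 1+\lfloor b/2\rfloor$ (indices mod $b$). -}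

module Defs where

open import Data.Nat using (ℕ; zero; suc; _+_; _*_; _∸_; _⊓_; _<_; _≤_; NonZero)
open import Data.Nat.DivMod using (_mod_; _/_)
open import Data.Fin using (Fin; toℕ)
import Data.Integer as ℤ
open ℤ using (ℤ; +_; -[1+_])
open import Data.Product using (_×_)

total : (b : ℕ) → (Fin b → ℕ) → ℕ
total zero    x = 0
total (suc b) x = x Fin.zero + total b (λ i → x (Fin.suc i))
  where import Data.Fin as Fin

window : (b : ℕ) .{{_ : NonZero b}} → (Fin b → ℕ) → ℕ → ℕ → ℕ
window b x i zero    = 0
window b x i (suc k) = x ((i + k) mod b) + window b x i k

minUpTo : ℕ → (ℕ → ℕ) → ℕ
minUpTo zero    f = f 0
minUpTo (suc n) f = minUpTo n f ⊓ f (suc n)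

μ : (b : ℕ) .{{_ : NonZero b}} → (Fin b → ℕ) → ℕ → ℕ
μ b x j = minUpTo (b ∸ 1) (λ i → window b x i j)

-- μ extended to integer indices: μ_{-1} = 0 (only j = -1 is used among negatives)
μℤ : (b : ℕ) .{{_ : NonZero b}} → (Fin b → ℕ) → ℤ → ℤ
μℤ b x (+ j)      = + μ b x j
μℤ b x -[1+ _ ]   = + 0

-- Regularity (with a red, b black beads, characteristic sequence x):
--   (a/b)k - 1 < S < (a/b)k + 1, multiplied through by b > 0:
--   a*k < b*(S+1)  and  b*S < a*k + b
Regular : (a b : ℕ) .{{_ : NonZero b}} → (Fin b → ℕ) → Set
Regular a b x =
  ∀ (i k : ℕ) → i < b → 1 ≤ k → k ≤ 1 + b / 2 →
    (a * k < b * (window b x i k + 1)) × (b * window b x i k < a * k + b)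

module Submission where

-- Write W(i,n) = x_i + … + x_{i+n-1} (indices mod b) and h = 1 + ⌊b/2⌋.
-- Regularity asks, for every start i and every length 1 ≤ k ≤ h, for the
-- lower bound  a·k < b·W(i,k) + b  and the upper bound  b·W(i,k) < a·k + b.
-- The point is that the two bounds are exchanged by passing to the
-- complementary window: W(i,n) + W(i+n, b-n) = a, so the lower bound for
-- (i,n) is equivalent to the upper bound for (i+n, b-n), and vice versa.
-- Since one of n, b-n is always at most h, regularity is equivalent to the
-- lower bound for ALL lengths 0 ≤ n ≤ b, and taking the minimum over the
-- start i this is exactly  a·n < b·(1 + μ_n).

open import Defs
open import Data.Nat using (ℕ; _<_; NonZero)
open import Data.Fin using (Fin)
open import Data.Integer using (ℤ; +_; -_; _*_; _+_; _≤_) renaming (_<_ to _<ℤ_)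
open import Relation.Binary.PropositionalEquality using (_≡_)
open import Function.Bundles using (_⇔_)

open import Data.Nat as ℕ using (zero; suc; _∸_; z≤n; s≤s)
open import Data.Nat.Properties
open import Data.Nat.DivMod using (_%_; _/_; _mod_; m%n<n; m%n%n≡m%n; %-distribˡ-+; n%n≡0; m<n⇒m%n≡m; m≡m%n+[m/n]*n; m/n<m)
open import Algebra.Properties.CommutativeSemigroup +-commutativeSemigroup using (x∙yz≈y∙xz)
open import Data.Nat.Tactic.RingSolver using (solve-∀)
import Data.Fin as Fin
open import Data.Fin.Properties using (fromℕ<-cong; fromℕ<-toℕ; toℕ<n)
import Data.Integer as ℤ
open import Data.Integer.Properties using (pos-*; drop‿+<+)
open import Data.Product using (_×_; _,_; ∃; proj₁; proj₂)
open import Data.Sum using (inj₁; inj₂)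
open import Relation.Nullary using (yes; no)
open import Relation.Binary.PropositionalEquality using (refl; sym; trans; cong; cong₂; subst; subst₂; module ≡-Reasoning)
open import Function.Bundles using (mk⇔; Equivalence)
open import Function.Base using (_∘_)
open import Function.Properties.Equivalence using () renaming (trans to ⇔-trans; sym to ⇔-sym)

module Windows (b : ℕ) .{{_ : NonZero b}} (x : Fin b → ℕ) where

  W : ℕ → ℕ → ℕ
  W = window b x

  window-mod : ∀ i k → W (i % b) k ≡ W i k
  window-mod i zero    = refl
  window-mod i (suc k) = cong₂ ℕ._+_ (cong x (fromℕ<-cong _ _ same-residue _ _)) (window-mod i k)
    where
    open ≡-Reasoning
    same-residue : (i % b ℕ.+ k) % b ≡ (i ℕ.+ k) % b
    same-residue = begin
      (i % b ℕ.+ k) % b           ≡⟨ %-distribˡ-+ (i % b) k b ⟩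
      (i % b % b ℕ.+ k % b) % b   ≡⟨ cong (λ r → (r ℕ.+ k % b) % b) (m%n%n≡m%n i b) ⟩
      (i % b ℕ.+ k % b) % b       ≡⟨ %-distribˡ-+ i k b ⟨
      (i ℕ.+ k) % b               ∎

  window-split : ∀ i k m → W i (k ℕ.+ m) ≡ W i k ℕ.+ W (i ℕ.+ k) m
  window-split i k zero    = trans (cong (W i) (+-identityʳ k)) (sym (+-identityʳ (W i k)))
  window-split i k (suc m) = begin
    W i (k ℕ.+ suc m)                                    ≡⟨ cong (W i) (+-suc k m) ⟩
    x ((i ℕ.+ (k ℕ.+ m)) mod b) ℕ.+ W i (k ℕ.+ m)
        ≡⟨ cong₂ (λ p q → x (p mod b) ℕ.+ q) (sym (+-assoc i k m)) (window-split i k m) ⟩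
    y ℕ.+ (W i k ℕ.+ W (i ℕ.+ k) m)                      ≡⟨ x∙yz≈y∙xz y (W i k) _ ⟩
    W i k ℕ.+ (y ℕ.+ W (i ℕ.+ k) m)                      ∎
    where
    open ≡-Reasoning
    y : ℕ
    y = x ((i ℕ.+ k ℕ.+ m) mod b)

  total-as-window : ∀ n i (y : Fin n → ℕ) →
                    (∀ t → y t ≡ x ((i ℕ.+ Fin.toℕ t) mod b)) → total n y ≡ W i n
  total-as-window zero    i y hy = refl
  total-as-window (suc n) i y hy = begin
    y Fin.zero ℕ.+ total n (λ t → y (Fin.suc t))
        ≡⟨ cong₂ ℕ._+_ (hy Fin.zero) (total-as-window n (suc i) _ shifted) ⟩
    x ((i ℕ.+ 0) mod b) ℕ.+ W (suc i) n     ≡⟨ cong₂ ℕ._+_ (sym (+-identityʳ _)) (cong (λ p → W p n) (+-comm 1 i)) ⟩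
    W i 1 ℕ.+ W (i ℕ.+ 1) n                 ≡⟨ window-split i 1 n ⟨
    W i (suc n)                             ∎
    where
    open ≡-Reasoning
    shifted : ∀ t → y (Fin.suc t) ≡ x ((suc i ℕ.+ Fin.toℕ t) mod b)
    shifted t = trans (hy (Fin.suc t)) (cong (λ p → x (p mod b)) (+-suc i (Fin.toℕ t)))

  -- Every window of length b covers the whole necklace: the window at 0 is
  -- the total by the previous lemma, and shifting the start by i does not
  -- change a full window (compare the two splittings of W 0 (i + b)).
  window-full : ∀ i → W i b ≡ total b x
  window-full i = +-cancelˡ-≡ (W 0 i) _ _ (begin
    W 0 i ℕ.+ W i b       ≡⟨ window-split 0 i b ⟨
    W 0 (i ℕ.+ b)         ≡⟨ cong (W 0) (+-comm i b) ⟩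
    W 0 (b ℕ.+ i)         ≡⟨ window-split 0 b i ⟩
    W 0 b ℕ.+ W b i       ≡⟨ cong₂ ℕ._+_ from-zero (trans (cong (λ r → W r i) (sym (n%n≡0 b))) (window-mod b i)) ⟨
    total b x ℕ.+ W 0 i   ≡⟨ +-comm (total b x) (W 0 i) ⟩
    W 0 i ℕ.+ total b x   ∎)
    where
    open ≡-Reasoning
    from-zero : total b x ≡ W 0 b
    from-zero = total-as-window b 0 x (λ t → cong x (sym (entry t)))
      where
      entry : ∀ t → Fin.toℕ t mod b ≡ t
      entry t = trans (fromℕ<-cong _ _ (m<n⇒m%n≡m (toℕ<n t)) _ (toℕ<n t)) (fromℕ<-toℕ t _)

  window-complement : ∀ i n → n ℕ.≤ b → W i n ℕ.+ W ((i ℕ.+ n) % b) (b ∸ n) ≡ total b x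
  window-complement i n n≤b = begin
    W i n ℕ.+ W ((i ℕ.+ n) % b) (b ∸ n)   ≡⟨ cong (W i n ℕ.+_) (window-mod (i ℕ.+ n) (b ∸ n)) ⟩
    W i n ℕ.+ W (i ℕ.+ n) (b ∸ n)         ≡⟨ window-split i n (b ∸ n) ⟨
    W i (n ℕ.+ (b ∸ n))                   ≡⟨ cong (W i) (m+[n∸m]≡n n≤b) ⟩
    W i b                                 ≡⟨ window-full i ⟩
    total b x                             ∎
    where open ≡-Reasoning

exchange-< : ∀ {p q r s t} → p ℕ.+ q ≡ r ℕ.+ s → p < r ℕ.+ t → s < q ℕ.+ t
exchange-< {p} {q} {r} {s} {t} eq p<r+t = +-cancelˡ-< r s (q ℕ.+ t) (begin-strict
  r ℕ.+ s           ≡⟨ eq ⟨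
  p ℕ.+ q           <⟨ +-monoˡ-< q p<r+t ⟩
  r ℕ.+ t ℕ.+ q     ≡⟨ +-assoc r t q ⟩
  r ℕ.+ (t ℕ.+ q)   ≡⟨ cong (r ℕ.+_) (+-comm t q) ⟩
  r ℕ.+ (q ℕ.+ t)   ∎)
  where open ≤-Reasoning

cross-balance : ∀ a b n m S S' → S ℕ.+ S' ≡ a → n ℕ.+ m ≡ b →
                a ℕ.* n ℕ.+ a ℕ.* m ≡ b ℕ.* S ℕ.+ b ℕ.* S'
cross-balance a b n m S S' refl refl = begin
  a ℕ.* n ℕ.+ a ℕ.* m   ≡⟨ *-distribˡ-+ a n m ⟨
  a ℕ.* (n ℕ.+ m)       ≡⟨ *-comm a (n ℕ.+ m) ⟩
  (n ℕ.+ m) ℕ.* a       ≡⟨ *-distribˡ-+ (n ℕ.+ m) S S' ⟩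
  (n ℕ.+ m) ℕ.* S ℕ.+ (n ℕ.+ m) ℕ.* S'   ∎
  where open ≡-Reasoning

lower⇒complement-upper : ∀ a b n m S S' → S ℕ.+ S' ≡ a → n ℕ.+ m ≡ b →
                          a ℕ.* n < b ℕ.* S ℕ.+ b → b ℕ.* S' < a ℕ.* m ℕ.+ b
lower⇒complement-upper a b n m S S' split-a split-b =
  exchange-< (cross-balance a b n m S S' split-a split-b)

complement-upper⇒lower : ∀ a b n m S S' → S ℕ.+ S' ≡ a → n ℕ.+ m ≡ b →
                          b ℕ.* S' < a ℕ.* m ℕ.+ b → a ℕ.* n < b ℕ.* S ℕ.+ b
complement-upper⇒lower a b n m S S' split-a split-b =
  exchange-< (trans (+-comm (b ℕ.* S') (b ℕ.* S))
             (trans (sym (cross-balance a b n m S S' split-a split-b)) (+-comm (a ℕ.* n) (a ℕ.* m))))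

*-suc-right : ∀ b s → b ℕ.* (s ℕ.+ 1) ≡ b ℕ.* s ℕ.+ b
*-suc-right b s = trans (*-distribˡ-+ b s 1) (cong (b ℕ.* s ℕ.+_) (*-identityʳ b))

*-suc-left : ∀ b s → b ℕ.* (1 ℕ.+ s) ≡ b ℕ.* s ℕ.+ b
*-suc-left b s = trans (*-suc b s) (+-comm b (b ℕ.* s))

below-twice-half : ∀ b → b < (1 ℕ.+ b / 2) ℕ.+ (1 ℕ.+ b / 2)
below-twice-half b = begin-strict
  b                         ≡⟨ m≡m%n+[m/n]*n b 2 ⟩
  b % 2 ℕ.+ b / 2 ℕ.* 2     <⟨ +-monoˡ-< (b / 2 ℕ.* 2) (m%n<n b 2) ⟩
  2 ℕ.+ b / 2 ℕ.* 2         ≡⟨ double (b / 2) ⟩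
  (1 ℕ.+ b / 2) ℕ.+ (1 ℕ.+ b / 2)   ∎
  where
  open ≤-Reasoning
  double : ∀ q → 2 ℕ.+ q ℕ.* 2 ≡ (1 ℕ.+ q) ℕ.+ (1 ℕ.+ q)
  double = solve-∀

complement-short : ∀ b n → 1 ℕ.+ b / 2 < n → b ∸ n ℕ.≤ 1 ℕ.+ b / 2
complement-short b n h<n = m≤n+o⇒m∸n≤o b n
  (<⇒≤ (<-≤-trans (below-twice-half b) (+-monoˡ-≤ (1 ℕ.+ b / 2) (<⇒≤ h<n))))

half≤ : ∀ b .{{_ : NonZero b}} → 1 ℕ.+ b / 2 ℕ.≤ b
half≤ b = m/n<m b 2 (s≤s (s≤s z≤n))

minUpTo-≤ : ∀ n f i → i ℕ.≤ n → minUpTo n f ℕ.≤ f i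
minUpTo-≤ zero    f .0 z≤n = ≤-refl
minUpTo-≤ (suc n) f i i≤1+n with i ℕ.≤? n
... | yes i≤n = ≤-trans (m⊓n≤m (minUpTo n f) _) (minUpTo-≤ n f i i≤n)
... | no  i≰n rewrite ≤-antisym i≤1+n (≰⇒> i≰n) = m⊓n≤n (minUpTo n f) _

minUpTo-attained : ∀ n f → ∃ λ i → i ℕ.≤ n × minUpTo n f ≡ f i
minUpTo-attained zero    f = 0 , z≤n , refl
minUpTo-attained (suc n) f with ⊓-sel (minUpTo n f) (f (suc n))
... | inj₁ min≡ = let (i , i≤n , eq) = minUpTo-attained n f in i , m≤n⇒m≤1+n i≤n , trans min≡ eq
... | inj₂ min≡ = suc n , ≤-refl , min≡

module Regularity (a b : ℕ) .{{_ : NonZero b}} (x : Fin b → ℕ) (total≡a : total b x ≡ a) where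
  open Windows b x

  Lower Upper : ℕ → ℕ → Set
  Lower i n = a ℕ.* n < b ℕ.* W i n ℕ.+ b
  Upper i n = b ℕ.* W i n < a ℕ.* n ℕ.+ b

  AllLower : Set
  AllLower = ∀ i n → i < b → n ℕ.≤ b → Lower i n

  next : ℕ → ℕ → ℕ
  next i n = (i ℕ.+ n) % b

  complement-sum : ∀ i n → n ℕ.≤ b → W i n ℕ.+ W (next i n) (b ∸ n) ≡ a
  complement-sum i n n≤b = trans (window-complement i n n≤b) total≡a

  empty-bounds : ∀ i → Lower i 0 × Upper i 0
  empty-bounds i rewrite *-zeroʳ a | *-zeroʳ b = ℕ.>-nonZero⁻¹ b , ℕ.>-nonZero⁻¹ b

  regular⇒short-bounds : Regular a b x → ∀ i n → i < b → n ℕ.≤ 1 ℕ.+ b / 2 → Lower i n × Upper i n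
  regular⇒short-bounds R i zero    i<b _   = empty-bounds i
  regular⇒short-bounds R i (suc n) i<b n≤h with R i (suc n) i<b (s≤s z≤n) n≤h
  ... | lower , upper = subst (a ℕ.* suc n <_) (*-suc-right b _) lower , upper

  -- A long window is handled through its short complement.
  regular⇒all-lower : Regular a b x → AllLower
  regular⇒all-lower R i n i<b n≤b with n ℕ.≤? 1 ℕ.+ b / 2
  ... | yes n≤h = proj₁ (regular⇒short-bounds R i n i<b n≤h)
  ... | no  n≰h = complement-upper⇒lower a b n (b ∸ n) (W i n) (W (next i n) (b ∸ n))
                    (complement-sum i n n≤b) (m+[n∸m]≡n n≤b)
                    (proj₂ (regular⇒short-bounds R (next i n) (b ∸ n) (m%n<n _ b) (complement-short b n (≰⇒> n≰h))))

  -- Conversely the upper bound of a window is the lower bound of its complement.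
  all-lower⇒regular : AllLower → Regular a b x
  all-lower⇒regular L i k i<b _ k≤h = subst (a ℕ.* k <_) (sym (*-suc-right b _)) (L i k i<b k≤b) , upper
    where
    k≤b : k ℕ.≤ b
    k≤b = ≤-trans k≤h (half≤ b)
    upper : Upper i k
    upper = lower⇒complement-upper a b (b ∸ k) k (W (next i k) (b ∸ k)) (W i k)
              (trans (+-comm (W (next i k) (b ∸ k)) (W i k)) (complement-sum i k k≤b)) (m∸n+n≡m k≤b)
              (L (next i k) (b ∸ k) (m%n<n _ b) (m∸n≤m b k))

  MinCondition : Set
  MinCondition = ∀ n → n ℕ.≤ b → a ℕ.* n < b ℕ.* (1 ℕ.+ μ b x n)

  all-lower⇒min : AllLower → MinCondition
  all-lower⇒min L n n≤b with minUpTo-attained (b ∸ 1) (λ i → W i n)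
  ... | i , i≤b-1 , μ≡ = subst (λ s → a ℕ.* n < b ℕ.* (1 ℕ.+ s)) (sym μ≡)
                          (subst (a ℕ.* n <_) (sym (*-suc-left b _)) (L i n (m≤pred[n]⇒suc[m]≤n i≤b-1) n≤b))

  min⇒all-lower : MinCondition → AllLower
  min⇒all-lower M i n i<b n≤b = <-≤-trans (subst (a ℕ.* n <_) (*-suc-left b _) (M n n≤b))
    (+-monoˡ-≤ b (*-monoʳ-≤ b (minUpTo-≤ (b ∸ 1) (λ j → W j n) i (<⇒≤pred i<b))))

  regular⇔min : Regular a b x ⇔ MinCondition
  regular⇔min = mk⇔ (all-lower⇒min ∘ regular⇒all-lower) (all-lower⇒regular ∘ min⇒all-lower)

pos-*-< : ∀ p q r s → (+ p * + q <ℤ + r * + s) ⇔ (p ℕ.* q < r ℕ.* s)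
pos-*-< p q r s = mk⇔
  (λ lt → drop‿+<+ (subst₂ _<ℤ_ (sym (pos-* p q)) (sym (pos-* r s)) lt))
  (λ lt → subst₂ _<ℤ_ (pos-* p q) (pos-* r s) (ℤ.+<+ lt))

-- The index j = -1: since a > 0 the left side  a·(-1)  is negative.
minus-one-index : ∀ a b → 0 < a → + a * - (+ 1) <ℤ + b * (+ 1 + + 0)
minus-one-index (suc a) b _ = subst (ℤ.-[1+ a ℕ.* 1 ] <ℤ_) (pos-* b 1) ℤ.-<+

integer⇔nat : ∀ a b .{{_ : NonZero b}} (x : Fin b → ℕ) → 0 < a →
  (∀ (j : ℤ) → - (+ 1) ≤ j → j ≤ + b → (+ a) * j <ℤ (+ b) * (+ 1 + μℤ b x j)) ⇔
  (∀ n → n ℕ.≤ b → a ℕ.* n < b ℕ.* (1 ℕ.+ μ b x n))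
integer⇔nat a b x 0<a = mk⇔
  (λ H n n≤b → Equivalence.to (pos-*-< a n b _) (H (+ n) ℤ.-≤+ (ℤ.+≤+ n≤b)))
  from
  where
  from : (∀ n → n ℕ.≤ b → a ℕ.* n < b ℕ.* (1 ℕ.+ μ b x n)) →
         ∀ (j : ℤ) → - (+ 1) ≤ j → j ≤ + b → (+ a) * j <ℤ (+ b) * (+ 1 + μℤ b x j)
  from M (+ n)        _              (ℤ.+≤+ n≤b) = Equivalence.from (pos-*-< a n b _) (M n n≤b)
  from M ℤ.-[1+ .0 ]  (ℤ.-≤- z≤n)    _           = minus-one-index a b 0<a

lemma1 : (a b : ℕ) → 0 < a → .{{_ : NonZero b}} → (x : Fin b → ℕ) → total b x ≡ a →
    (Regular a b x ⇔
      (∀ (j : ℤ) → - (+ 1) ≤ j → j ≤ + b → (+ a) * j <ℤ (+ b) * (+ 1 + μℤ b x j)))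
lemma1 a b 0<a x total≡a =
  ⇔-trans (Regularity.regular⇔min a b x total≡a) (⇔-sym (integer⇔nat a b x 0<a))
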